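{- Let $k\ge1$ and let $S_k$ be the star graph with one internal node and $k$ leaves. Then the spectrum of $\mathrm{CNSL}(S_k)$ is $\{0^1,(2(k-1))^1,(k-2)^{k-1}\}$ and $LE^+_{CN}(S_k)=\frac{2(k-1)(k+2)}{k+1}$. Moreover, $S_k$ is not CNSL-hyperenergetic.
   Context: Spectra are multisets, $x^a$ meaning eigenvalue $x$ of multiplicity $a$. For a finite simple graph $\mathcal{G}$ on vertices $v_1,\dots,v_p$: $\mathrm{CN}(\mathcal{G})$ has $(i,j)$-entry $|N(v_i)\cap N(v_j)|$ for $i\neq j$ (open neighbourhoods) and $0$ on the diagonal; $\mathrm{CNRS}(\mathcal{G})$ is the diagonal matrix of row sums of $\mathrm{CN}(\mathcal{G})$; $\mathrm{CNSL}(\mathcal{G})=\mathrm{CNRS}(\mathcal{G})+\mathrm{CN}(\mathcal{G})$. $LE^+_{CN}(\mathcal{G})=\sum_\sigma|\sigma-tr(\mathrm{CNRS}(\mathcal{G}))/p|$ over the eigenvalues $\sigma$ of $\mathrm{CNSL}(\mathcal{G})$ with multiplicity. $\mathcal{G}$ on $p$ vertices is CNSL-hyperenergetic if $LE^+_{CN}(\mathcal{G})>LE^+_{CN}(K_p)$. -}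

module Defs where

open import Data.Nat as ℕ using (ℕ; zero; suc)
open import Data.Fin using (Fin; zero; suc; punchIn)
open import Data.Bool using (Bool; true; false; _∧_)
open import Data.List using (List; []; _∷_; map; replicate; foldr; _++_)
open import Data.Integer as ℤ using (ℤ; +_)
open import Data.Rational using (ℚ; 0ℚ; 1ℚ; _+_; _*_; _-_; -_; ∣_∣; _/_; _<_)
open import Data.Product using (Σ-syntax; _×_)
open import Relation.Binary.PropositionalEquality using (_≡_; _≢_)

record Graph (p : ℕ) : Set where
  field
    adj    : Fin p → Fin p → Bool
    sym    : ∀ i j → adj i j ≡ adj j i
    irrefl : ∀ i → adj i i ≡ false
open Graph public

Matrix : ℕ → Set
Matrix n = Fin n → Fin n → ℚ

Σℚ : (n : ℕ) → (Fin n → ℚ) → ℚ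
Σℚ zero    f = 0ℚ
Σℚ (suc n) f = f zero + Σℚ n (λ i → f (suc i))

b2q : Bool → ℚ
b2q true  = 1ℚ
b2q false = 0ℚ

eqFin : ∀ {n} → Fin n → Fin n → Bool
eqFin zero    zero    = true
eqFin zero    (suc _) = false
eqFin (suc _) zero    = false
eqFin (suc i) (suc j) = eqFin i j

commonNbrs : ∀ {p} → Graph p → Fin p → Fin p → ℚ
commonNbrs {p} G i j = Σℚ p (λ w → b2q (adj G i w ∧ adj G j w))

CN : ∀ {p} → Graph p → Matrix p
CN G i j with eqFin i j
... | true  = 0ℚ
... | false = commonNbrs G i j

CNRS : ∀ {p} → Graph p → Matrix p
CNRS {p} G i j with eqFin i j
... | true  = Σℚ p (λ l → CN G i l)
... | false = 0ℚ

CNSL : ∀ {p} → Graph p → Matrix p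
CNSL G i j = CNRS G i j + CN G i j

trace : ∀ {n} → Matrix n → ℚ
trace {n} M = Σℚ n (λ i → M i i)

det : (n : ℕ) → Matrix n → ℚ
det zero    M = 1ℚ
det (suc n) M = go n (λ j → M zero j) (λ j i' j' → M (suc i') (punchIn j j')) 1ℚ
  where
  go : (m : ℕ) → (Fin (suc m) → ℚ) → (Fin (suc m) → Matrix n) → ℚ → ℚ
  go zero    r mi s = s * r zero * det n (mi zero)
  go (suc m) r mi s = s * r zero * det n (mi zero)
                      + go m (λ j → r (suc j)) (λ j → mi (suc j)) (- s)

charPolyAt : ∀ {n} → Matrix n → ℚ → ℚ
charPolyAt {n} M x = det n (λ i j → (if' (eqFin i j) x) - M i j)
  where
  if' : Bool → ℚ → ℚ
  if' true  y = y
  if' false _ = 0ℚ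

prodℚ : List ℚ → ℚ
prodℚ = foldr _*_ 1ℚ

sumℚ : List ℚ → ℚ
sumℚ = foldr _+_ 0ℚ

-- `ls` is the spectrum of M (eigenvalues listed with multiplicity):
-- det(xI - M) = ∏_{σ ∈ ls} (x - σ) as polynomials (equivalently, for all x ∈ ℚ).
IsSpectrum : ∀ {n} → Matrix n → List ℚ → Set
IsSpectrum M ls = ∀ x → charPolyAt M x ≡ prodℚ (map (λ σ → x - σ) ls)

LEfrom : ∀ {n} → Graph (suc n) → List ℚ → ℚ
LEfrom {n} G ls = sumℚ (map (λ σ → ∣ σ - trace (CNRS G) * ((+ 1) / suc n) ∣) ls)

LEPlusCN≡ : ∀ {n} → Graph (suc n) → ℚ → Set
LEPlusCN≡ G v = Σ[ ls ∈ List ℚ ] (IsSpectrum (CNSL G) ls × LEfrom G ls ≡ v)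

complete : (p : ℕ) → Graph p
complete p = record { adj = λ i j → not' (eqFin i j) ; sym = symK ; irrefl = irrK }
  where
  not' : Bool → Bool
  not' true = false
  not' false = true
  eqSym : ∀ {m} (i j : Fin m) → eqFin i j ≡ eqFin j i
  eqSym zero zero = _≡_.refl
  eqSym zero (suc j) = _≡_.refl
  eqSym (suc i) zero = _≡_.refl
  eqSym (suc i) (suc j) = eqSym i j
  symK : ∀ i j → not' (eqFin i j) ≡ not' (eqFin j i)
  symK i j rewrite eqSym i j = _≡_.refl
  eqRefl : ∀ {m} (i : Fin m) → eqFin i i ≡ true
  eqRefl zero = _≡_.refl
  eqRefl (suc i) = eqRefl i
  irrK : ∀ i → not' (eqFin i i) ≡ false
  irrK i rewrite eqRefl i = _≡_.refl

CNSLHyperenergetic : ∀ {n} → Graph (suc n) → Set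
CNSLHyperenergetic {n} G =
  Σ[ a ∈ ℚ ] Σ[ b ∈ ℚ ] (LEPlusCN≡ G a × LEPlusCN≡ (complete (suc n)) b × b < a)

-- star S_k on Fin (suc k): vertex zero is the internal node, others are leaves
starAdj : ∀ {k} → Fin (suc k) → Fin (suc k) → Bool
starAdj zero    zero    = false
starAdj zero    (suc _) = true
starAdj (suc _) zero    = true
starAdj (suc _) (suc _) = false

star : (k : ℕ) → Graph (suc k)
star k = record { adj = starAdj ; sym = s ; irrefl = ir }
  where
  s : ∀ i j → starAdj i j ≡ starAdj j i
  s zero zero = _≡_.refl
  s zero (suc j) = _≡_.refl
  s (suc i) zero = _≡_.refl
  s (suc i) (suc j) = _≡_.refl
  ir : ∀ i → starAdj i i ≡ false
  ir zero = _≡_.refl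
  ir (suc i) = _≡_.refl

ℤ→ℚ : ℤ → ℚ
ℤ→ℚ z = z / 1

{-# OPTIONS --safe #-}
-- In the star S_k the centre shares no neighbour with any vertex and two distinct leaves share
-- exactly the centre, so CNSL(S_k) = 0 ⊕ ((k-2)I + J); in K_p any two vertices share p-2
-- neighbours, so CNSL(K_p) = (p-2)²I + (p-2)J.  Expanding along the first row,
-- det((α-β)I + βJ) = (α-β)^(n-1) (α + (n-1)β) for n × n matrices, which gives both spectra, and the
-- energies 2(k-1)(k+2)/(k+1) of S_k and 2k(k-1) of K_(k+1) compare since (k-1)(k+2) ≤ k(k-1)(k+1).
-- As the energy is defined through any list of eigenvalues, one also needs that the characteristic
-- polynomial determines that list up to order: a polynomial vanishing at all large rationals is
-- zero, so common roots can be cancelled one at a time.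
module Submission where

open import Function using (_∘_)
open import Data.Product using (_×_; _,_)
open import Data.Nat as ℕ using (ℕ; zero; suc; _≥_; _∸_)
import Data.Nat.Properties as ℕ
import Data.Nat.Tactic.RingSolver as ℕ-Ring
open import Data.Fin using (Fin; zero; suc; punchIn)
open import Data.Bool using (true; false; not; _∧_; if_then_else_)
open import Data.Bool.Properties using (∧-identityʳ)
open import Data.List using (List; []; _∷_; _++_; map; replicate; length)
open import Data.List.Properties using (map-cong; map-replicate)
open import Data.List.Membership.Propositional using (_∈_)
open import Data.List.Membership.Propositional.Properties using (∈-∃++)
open import Data.List.Relation.Unary.Any using (here; there)
open import Data.List.Relation.Binary.Permutation.Propositional using (_↭_; ↭-refl; ↭-prep; ↭-trans; ↭-sym; ↭⇒↭ₛ)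
open import Data.List.Relation.Binary.Permutation.Propositional.Properties using (map⁺; shift)
open import Data.List.Relation.Binary.Permutation.Setoid.Properties using (foldr-commMonoid)
open import Data.Integer as ℤ using (ℤ; +_)
import Data.Integer.Properties as ℤ
import Data.Integer.Tactic.RingSolver as ℤ-Ring
open import Data.Rational as ℚ using (ℚ; 0ℚ; 1ℚ; _+_; _*_; _-_; -_; _/_; 1/_; ∣_∣; _≤_; _<_; fromℚᵘ)
import Data.Rational.Properties as ℚ
import Data.Rational.Unnormalised as ℚᵘ
import Data.Rational.Unnormalised.Properties as ℚᵘ
open import Algebra.Properties.Group ℚ.+-0-group using (x∙y⁻¹≈ε⇒x≈y)
open import Relation.Nullary using (¬_; yes; no)
open import Relation.Binary.PropositionalEquality
open import Data.Rational.Solver using (module +-*-Solver)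
open import Defs hiding (sym)

open +-*-Solver using (solve; _:+_; _:*_; _:-_; :-_; con; _:=_)

ℕ→ℚ : ℕ → ℚ
ℕ→ℚ n = ℤ→ℚ (+ n)

private
  fromℚᵘ-homo-+ : ∀ p q → fromℚᵘ (p ℚᵘ.+ q) ≡ fromℚᵘ p + fromℚᵘ q
  fromℚᵘ-homo-+ p q = ℚ.toℚᵘ-injective (begin
    ℚ.toℚᵘ (fromℚᵘ (p ℚᵘ.+ q))                      ≈⟨ ℚ.toℚᵘ-fromℚᵘ (p ℚᵘ.+ q) ⟩
    p ℚᵘ.+ q                                        ≈⟨ ℚᵘ.+-cong (ℚᵘ.≃-sym (ℚ.toℚᵘ-fromℚᵘ p)) (ℚᵘ.≃-sym (ℚ.toℚᵘ-fromℚᵘ q)) ⟩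
    ℚ.toℚᵘ (fromℚᵘ p) ℚᵘ.+ ℚ.toℚᵘ (fromℚᵘ q)        ≈⟨ ℚᵘ.≃-sym (ℚ.toℚᵘ-homo-+ (fromℚᵘ p) (fromℚᵘ q)) ⟩
    ℚ.toℚᵘ (fromℚᵘ p + fromℚᵘ q)                    ∎)
    where open ℚᵘ.≃-Reasoning

  fromℚᵘ-homo-* : ∀ p q → fromℚᵘ (p ℚᵘ.* q) ≡ fromℚᵘ p * fromℚᵘ q
  fromℚᵘ-homo-* p q = ℚ.toℚᵘ-injective (begin
    ℚ.toℚᵘ (fromℚᵘ (p ℚᵘ.* q))                      ≈⟨ ℚ.toℚᵘ-fromℚᵘ (p ℚᵘ.* q) ⟩
    p ℚᵘ.* q                                        ≈⟨ ℚᵘ.*-cong (ℚᵘ.≃-sym (ℚ.toℚᵘ-fromℚᵘ p)) (ℚᵘ.≃-sym (ℚ.toℚᵘ-fromℚᵘ q)) ⟩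
    ℚ.toℚᵘ (fromℚᵘ p) ℚᵘ.* ℚ.toℚᵘ (fromℚᵘ q)        ≈⟨ ℚᵘ.≃-sym (ℚ.toℚᵘ-homo-* (fromℚᵘ p) (fromℚᵘ q)) ⟩
    ℚ.toℚᵘ (fromℚᵘ p * fromℚᵘ q)                    ∎)
    where open ℚᵘ.≃-Reasoning

ℤ→ℚ-homo-+ : ∀ a b → ℤ→ℚ (a ℤ.+ b) ≡ ℤ→ℚ a + ℤ→ℚ b
ℤ→ℚ-homo-+ a b = trans (ℚ.fromℚᵘ-cong {ℚᵘ.mkℚᵘ (a ℤ.+ b) 0} {ℚᵘ.mkℚᵘ a 0 ℚᵘ.+ ℚᵘ.mkℚᵘ b 0} (ℚᵘ.*≡* (eq a b)))
                       (fromℚᵘ-homo-+ (ℚᵘ.mkℚᵘ a 0) (ℚᵘ.mkℚᵘ b 0))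
  where
  eq : ∀ a b → (a ℤ.+ b) ℤ.* + 1 ≡ (a ℤ.* + 1 ℤ.+ b ℤ.* + 1) ℤ.* + 1
  eq = ℤ-Ring.solve-∀

ℤ→ℚ-homo-* : ∀ a b → ℤ→ℚ (a ℤ.* b) ≡ ℤ→ℚ a * ℤ→ℚ b
ℤ→ℚ-homo-* a b = trans (ℚ.fromℚᵘ-cong {ℚᵘ.mkℚᵘ (a ℤ.* b) 0} {ℚᵘ.mkℚᵘ a 0 ℚᵘ.* ℚᵘ.mkℚᵘ b 0} (ℚᵘ.*≡* refl))
                       (fromℚᵘ-homo-* (ℚᵘ.mkℚᵘ a 0) (ℚᵘ.mkℚᵘ b 0))

/-as-* : ∀ z d → z / suc d ≡ ℤ→ℚ z * (+ 1 / suc d)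
/-as-* z d = trans (ℚ.fromℚᵘ-cong {ℚᵘ.mkℚᵘ z d} {ℚᵘ.mkℚᵘ z 0 ℚᵘ.* ℚᵘ.mkℚᵘ (+ 1) d} (ℚᵘ.*≡* eq))
                   (fromℚᵘ-homo-* (ℚᵘ.mkℚᵘ z 0) (ℚᵘ.mkℚᵘ (+ 1) d))
  where
  *-unit : ∀ z e → z ℤ.* e ≡ z ℤ.* + 1 ℤ.* e
  *-unit = ℤ-Ring.solve-∀
  eq : z ℤ.* + (suc d ℕ.+ 0) ≡ z ℤ.* + 1 ℤ.* + suc d
  eq = trans (cong (λ n → z ℤ.* + n) (ℕ.+-identityʳ (suc d))) (*-unit z (+ suc d))

ℕ→ℚ-homo-+ : ∀ m n → ℕ→ℚ (m ℕ.+ n) ≡ ℕ→ℚ m + ℕ→ℚ n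
ℕ→ℚ-homo-+ m n = ℤ→ℚ-homo-+ (+ m) (+ n)

ℕ→ℚ-homo-* : ∀ m n → ℕ→ℚ (m ℕ.* n) ≡ ℕ→ℚ m * ℕ→ℚ n
ℕ→ℚ-homo-* m n = trans (cong ℤ→ℚ (ℤ.pos-* m n)) (ℤ→ℚ-homo-* (+ m) (+ n))

ℕ→ℚ-suc : ∀ n → ℕ→ℚ (suc n) ≡ 1ℚ + ℕ→ℚ n
ℕ→ℚ-suc = ℕ→ℚ-homo-+ 1

ℕ→ℚ-*-inverse : ∀ d → ℕ→ℚ (suc d) * (+ 1 / suc d) ≡ 1ℚ
ℕ→ℚ-*-inverse d = trans (sym (/-as-* (+ suc d) d))
  (ℚ.fromℚᵘ-cong {ℚᵘ.mkℚᵘ (+ suc d) d} {ℚᵘ.mkℚᵘ (+ 1) 0} (ℚᵘ.*≡* (ℤ.*-comm (+ suc d) (+ 1))))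

ℕ→ℚ-mono-≤ : ∀ {m n} → m ℕ.≤ n → ℕ→ℚ m ≤ ℕ→ℚ n
ℕ→ℚ-mono-≤ {m} {n} m≤n = ℚ.toℚᵘ-cancel-≤
  (ℚᵘ.≤-respˡ-≃ (ℚᵘ.≃-sym (ℚ.toℚᵘ-fromℚᵘ (ℚᵘ.mkℚᵘ (+ m) 0)))
  (ℚᵘ.≤-respʳ-≃ (ℚᵘ.≃-sym (ℚ.toℚᵘ-fromℚᵘ (ℚᵘ.mkℚᵘ (+ n) 0)))
  (ℚᵘ.*≤* (ℤ.*-monoʳ-≤-nonNeg (+ 1) (ℤ.+≤+ m≤n)))))

ℕ→ℚ-nonNeg : ∀ n → 0ℚ ≤ ℕ→ℚ n
ℕ→ℚ-nonNeg n = ℕ→ℚ-mono-≤ {0} {n} ℕ.z≤n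

1/suc-nonNeg : ∀ d → 0ℚ ≤ + 1 / suc d
1/suc-nonNeg d = ℚ.nonNegative⁻¹ _ {{ℚ.normalize-nonNeg 1 (suc d)}}

Σ-cong : ∀ {n} {f g : Fin n → ℚ} → (∀ i → f i ≡ g i) → Σℚ n f ≡ Σℚ n g
Σ-cong {zero}  f≗g = refl
Σ-cong {suc n} f≗g = cong₂ _+_ (f≗g zero) (Σ-cong (f≗g ∘ suc))

Σ-const : ∀ n v → Σℚ n (λ _ → v) ≡ ℕ→ℚ n * v
Σ-const zero    v = sym (ℚ.*-zeroˡ v)
Σ-const (suc n) v = begin
  v + Σℚ n (λ _ → v)  ≡⟨ cong (_+_ v) (Σ-const n v) ⟩
  v + ℕ→ℚ n * v       ≡⟨ step v (ℕ→ℚ n) ⟩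
  (1ℚ + ℕ→ℚ n) * v    ≡⟨ cong (_* v) (ℕ→ℚ-suc n) ⟨
  ℕ→ℚ (suc n) * v     ∎
  where
  open ≡-Reasoning
  step : ∀ v s → v + s * v ≡ (1ℚ + s) * v
  step = solve 2 (λ v s → v :+ s :* v := (con 1ℚ :+ s) :* v) refl

Σ-zero : ∀ {n} {f : Fin n → ℚ} → (∀ i → f i ≡ 0ℚ) → Σℚ n f ≡ 0ℚ
Σ-zero {n} f≗0 = trans (Σ-cong f≗0) (trans (Σ-const n 0ℚ) (ℚ.*-zeroʳ (ℕ→ℚ n)))

Σ-δ : ∀ m (i : Fin (suc m)) a b → Σℚ (suc m) (λ l → if eqFin i l then a else b) ≡ a + ℕ→ℚ m * b
Σ-δ m       zero    a b = cong (_+_ a) (Σ-const m b)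
Σ-δ (suc m) (suc i) a b = begin
  b + Σℚ (suc m) (λ l → if eqFin i l then a else b)  ≡⟨ cong (_+_ b) (Σ-δ m i a b) ⟩
  b + (a + ℕ→ℚ m * b)                                 ≡⟨ step a b (ℕ→ℚ m) ⟩
  a + (1ℚ + ℕ→ℚ m) * b                                ≡⟨ cong (λ s → a + s * b) (ℕ→ℚ-suc m) ⟨
  a + ℕ→ℚ (suc m) * b                                 ∎
  where
  open ≡-Reasoning
  step : ∀ a b s → b + (a + s * b) ≡ a + (1ℚ + s) * b
  step = solve 3 (λ a b s → b :+ (a :+ s :* b) := a :+ (con 1ℚ :+ s) :* b) refl

-- Determinants

minor : ∀ {n} → Matrix (suc n) → Fin (suc n) → Matrix n
minor M j i j′ = M (suc i) (punchIn j j′)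

sign : ∀ {n} → Fin n → ℚ
sign zero    = 1ℚ
sign (suc j) = - sign j

sign² : ∀ {n} (j : Fin n) → sign j * sign j ≡ 1ℚ
sign² zero    = refl
sign² (suc j) = trans (neg*neg (sign j)) (sign² j)
  where
  neg*neg : ∀ s → - s * - s ≡ s * s
  neg*neg = solve 1 (λ s → :- s :* :- s := s :* s) refl

private
  cofactorSum : (n m : ℕ) → (Fin (suc m) → ℚ) → (Fin (suc m) → Matrix n) → ℚ → ℚ
  cofactorSum n zero    r ms s = s * r zero * det n (ms zero)
  cofactorSum n (suc m) r ms s = s * r zero * det n (ms zero) + cofactorSum n m (r ∘ suc) (ms ∘ suc) (- s)

  module _ (go : (n : ℕ) → Matrix (suc n) → (m : ℕ) → (Fin (suc m) → ℚ) → (Fin (suc m) → Matrix n) → ℚ → ℚ)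
           (go-zero : ∀ n M r ms s → go n M zero r ms s ≡ cofactorSum n zero r ms s)
           (go-suc : ∀ n M m r ms s → go n M (suc m) r ms s ≡ s * r zero * det n (ms zero) + go n M m (r ∘ suc) (ms ∘ suc) (- s))
           where
    go≡cofactorSum : ∀ n M m r ms s → go n M m r ms s ≡ cofactorSum n m r ms s
    go≡cofactorSum n M zero    r ms s = go-zero n M r ms s
    go≡cofactorSum n M (suc m) r ms s =
      trans (go-suc n M m r ms s) (cong (_+_ (s * r zero * det n (ms zero))) (go≡cofactorSum n M m (r ∘ suc) (ms ∘ suc) (- s)))

  -- `det` recurses through a helper `go` local to it, of which `cofactorSum` is a copy.  The `with`
  -- turns the arguments of `go` into variables, so that `go≡cofactorSum` can be instantiated with
  -- `go` by unification.
  det≡cofactorSum : ∀ n (M : Matrix (suc n)) → det (suc n) M ≡ cofactorSum n n (M zero) (minor M) 1ℚ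
  det≡cofactorSum zero          M = refl
  det≡cofactorSum (suc zero)    M = refl
  det≡cofactorSum (suc (suc n)) M
    with go≡cofactorSum _ (λ _ _ _ _ _ → refl) (λ _ _ _ _ _ _ → refl)
       | n | ℕ.suc (ℕ.suc n) | M | (λ j → M zero (suc (suc j))) | (λ j → minor M (suc (suc j))) | - (- 1ℚ)
       | 1ℚ * M zero zero * det (suc (suc n)) (minor M zero)
       | - 1ℚ * M zero (suc zero) * det (suc (suc n)) (minor M (suc zero))
  ... | go≡cofactorSum′ | m | P | M′ | r | ms | s | a | b = cong (_+_ a) (cong (_+_ b) (go≡cofactorSum′ P M′ m r ms s))

  cofactorSum≡Σ : ∀ n m r ms s → cofactorSum n m r ms s ≡ Σℚ (suc m) (λ j → s * sign j * r j * det n (ms j))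
  cofactorSum≡Σ n zero    r ms s = unit s (r zero) (det n (ms zero))
    where
    unit : ∀ s a d → s * a * d ≡ s * 1ℚ * a * d + 0ℚ
    unit = solve 3 (λ s a d → s :* a :* d := s :* con 1ℚ :* a :* d :+ con 0ℚ) refl
  cofactorSum≡Σ n (suc m) r ms s =
    cong₂ _+_ (unit s (r zero) (det n (ms zero)))
              (trans (cofactorSum≡Σ n m (r ∘ suc) (ms ∘ suc) (- s)) (Σ-cong λ j → flip s (sign j) (r (suc j)) (det n (ms (suc j)))))
    where
    unit : ∀ s a d → s * a * d ≡ s * 1ℚ * a * d
    unit = solve 3 (λ s a d → s :* a :* d := s :* con 1ℚ :* a :* d) refl
    flip : ∀ s σ a d → - s * σ * a * d ≡ s * - σ * a * d
    flip = solve 4 (λ s σ a d → :- s :* σ :* a :* d := s :* :- σ :* a :* d) refl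

laplace : ∀ n (M : Matrix (suc n)) → det (suc n) M ≡ Σℚ (suc n) (λ j → sign j * M zero j * det n (minor M j))
laplace n M = trans (det≡cofactorSum n M) (trans (cofactorSum≡Σ n n (M zero) (minor M) 1ℚ)
  (Σ-cong λ j → cong (λ σ → σ * M zero j * det n (minor M j)) (ℚ.*-identityˡ (sign j))))

det-cong : ∀ {n} {M N : Matrix n} → (∀ i j → M i j ≡ N i j) → det n M ≡ det n N
det-cong {zero}          M≗N = refl
det-cong {suc n} {M} {N} M≗N = begin
  det (suc n) M                                                  ≡⟨ laplace n M ⟩
  Σℚ (suc n) (λ j → sign j * M zero j * det n (minor M j))       ≡⟨ Σ-cong cofactor-cong ⟩
  Σℚ (suc n) (λ j → sign j * N zero j * det n (minor N j))       ≡⟨ laplace n N ⟨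
  det (suc n) N                                                  ∎
  where
  open ≡-Reasoning
  cofactor-cong : ∀ j → sign j * M zero j * det n (minor M j) ≡ sign j * N zero j * det n (minor N j)
  cofactor-cong j = cong₂ (λ a d → sign j * a * d) (M≗N zero j) (det-cong λ i j′ → M≗N (suc i) (punchIn j j′))

infixr 5 _⊕_
_⊕_ : ∀ {n} → ℚ → Matrix n → Matrix (suc n)
(a ⊕ M) zero    zero    = a
(a ⊕ M) zero    (suc j) = 0ℚ
(a ⊕ M) (suc i) zero    = 0ℚ
(a ⊕ M) (suc i) (suc j) = M i j

det-⊕ : ∀ n a (M : Matrix n) → det (suc n) (a ⊕ M) ≡ a * det n M
det-⊕ n a M = begin
  det (suc n) (a ⊕ M)                                              ≡⟨ laplace n (a ⊕ M) ⟩
  1ℚ * a * det n M + Σℚ n (λ j → sign (suc j) * 0ℚ * det n (minor (a ⊕ M) (suc j)))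
    ≡⟨ cong (_+_ (1ℚ * a * det n M)) (Σ-zero λ j → times-0 (sign (suc j)) (det n (minor (a ⊕ M) (suc j)))) ⟩
  1ℚ * a * det n M + 0ℚ                                            ≡⟨ unit a (det n M) ⟩
  a * det n M                                                      ∎
  where
  open ≡-Reasoning
  times-0 : ∀ σ d → σ * 0ℚ * d ≡ 0ℚ
  times-0 = solve 2 (λ σ d → σ :* con 0ℚ :* d := con 0ℚ) refl
  unit : ∀ a d → 1ℚ * a * d + 0ℚ ≡ a * d
  unit = solve 2 (λ a d → con 1ℚ :* a :* d :+ con 0ℚ := a :* d) refl

cofactors₂ : ∀ n → Matrix (suc (suc n)) → ℚ
cofactors₂ n M = Σℚ n (λ j → sign (suc (suc j)) * M zero (suc (suc j)) * det (suc n) (minor M (suc (suc j))))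

col₀≡col₁⇒det≡0 : ∀ n (M : Matrix (suc (suc n))) → (∀ i → M i zero ≡ M i (suc zero)) → det (suc (suc n)) M ≡ 0ℚ
col₀≡col₁⇒cofactors₂≡0 : ∀ n (M : Matrix (suc (suc n))) → (∀ i → M (suc i) zero ≡ M (suc i) (suc zero)) → cofactors₂ n M ≡ 0ℚ

col₀≡col₁⇒det≡0 n M col₀≡col₁ = begin
  det (suc (suc n)) M                                                       ≡⟨ laplace (suc n) M ⟩
  1ℚ * a * D + (- 1ℚ * M zero (suc zero) * det (suc n) (minor M (suc zero)) + cofactors₂ n M)
    ≡⟨ cong₂ (λ b D′ → 1ℚ * a * D + (- 1ℚ * b * D′ + cofactors₂ n M)) (sym (col₀≡col₁ zero)) (det-cong minor₁≗minor₀) ⟩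
  1ℚ * a * D + (- 1ℚ * a * D + cofactors₂ n M)
    ≡⟨ cong (λ t → 1ℚ * a * D + (- 1ℚ * a * D + t)) (col₀≡col₁⇒cofactors₂≡0 n M (col₀≡col₁ ∘ suc)) ⟩
  1ℚ * a * D + (- 1ℚ * a * D + 0ℚ)                                          ≡⟨ cancel a D ⟩
  0ℚ                                                                        ∎
  where
  open ≡-Reasoning
  a = M zero zero
  D = det (suc n) (minor M zero)
  minor₁≗minor₀ : ∀ i j → minor M (suc zero) i j ≡ minor M zero i j
  minor₁≗minor₀ i zero    = col₀≡col₁ (suc i)
  minor₁≗minor₀ i (suc j) = refl
  cancel : ∀ a d → 1ℚ * a * d + (- 1ℚ * a * d + 0ℚ) ≡ 0ℚ
  cancel = solve 2 (λ a d → con 1ℚ :* a :* d :+ (:- con 1ℚ :* a :* d :+ con 0ℚ) := con 0ℚ) refl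

col₀≡col₁⇒cofactors₂≡0 zero    M _         = refl
col₀≡col₁⇒cofactors₂≡0 (suc n) M col₀≡col₁ = Σ-zero λ j →
  let c = sign (suc (suc j)) * M zero (suc (suc j)) in
  trans (cong (_*_ c) (col₀≡col₁⇒det≡0 n (minor M (suc (suc j))) col₀≡col₁)) (ℚ.*-zeroʳ c)

infixr 8 _^_
_^_ : ℚ → ℕ → ℚ
c ^ n = prodℚ (replicate n c)

diagOffDiag : ∀ {n} → ℚ → ℚ → Matrix n
diagOffDiag α β i j = if eqFin i j then α else β

offMinor : ∀ {n} → ℚ → ℚ → Fin (suc n) → Matrix (suc n)
offMinor α β r i zero    = β
offMinor α β r i (suc j) = if eqFin i (punchIn r j) then α else β

minor-diagOffDiag : ∀ {n} α β (r : Fin (suc n)) i j → minor (diagOffDiag α β) (suc r) i j ≡ offMinor α β r i j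
minor-diagOffDiag α β r i zero    = refl
minor-diagOffDiag α β r i (suc j) = refl

det-diagOffDiag : ∀ n α β → det (suc n) (diagOffDiag α β) ≡ (α - β) ^ n * ((α - β) + ℕ→ℚ (suc n) * β)
det-offMinor : ∀ n α β (r : Fin (suc n)) → det (suc n) (offMinor α β r) ≡ sign r * β * (α - β) ^ n

private
  offMinor-cofactors : ∀ n α β →
    Σℚ (suc n) (λ j → sign (suc j) * β * det (suc n) (offMinor α β j)) ≡ - (ℕ→ℚ (suc n) * (β * β * (α - β) ^ n))
  offMinor-cofactors n α β = begin
    Σℚ (suc n) (λ j → sign (suc j) * β * det (suc n) (offMinor α β j))  ≡⟨ Σ-cong {suc n} cofactor ⟩
    Σℚ (suc n) (λ _ → - (β * β * p))                                   ≡⟨ Σ-const (suc n) (- (β * β * p)) ⟩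
    ℕ→ℚ (suc n) * - (β * β * p)                                         ≡⟨ ℚ.neg-distribʳ-* (ℕ→ℚ (suc n)) (β * β * p) ⟨
    - (ℕ→ℚ (suc n) * (β * β * p))                                       ∎
    where
    open ≡-Reasoning
    p = (α - β) ^ n
    regroup : ∀ s b p → - s * b * (s * b * p) ≡ - (s * s * (b * b * p))
    regroup = solve 3 (λ s b p → :- s :* b :* (s :* b :* p) := :- (s :* s :* (b :* b :* p))) refl
    cofactor : ∀ j → sign (suc j) * β * det (suc n) (offMinor α β j) ≡ - (β * β * p)
    cofactor j = begin
      - sign j * β * det (suc n) (offMinor α β j)   ≡⟨ cong (_*_ (- sign j * β)) (det-offMinor n α β j) ⟩
      - sign j * β * (sign j * β * p)               ≡⟨ regroup (sign j) β p ⟩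
      - (sign j * sign j * (β * β * p))             ≡⟨ cong (λ t → - (t * (β * β * p))) (sign² j) ⟩
      - (1ℚ * (β * β * p))                          ≡⟨ cong -_ (ℚ.*-identityˡ _) ⟩
      - (β * β * p)                                 ∎

det-diagOffDiag zero    α β = unit α β
  where
  unit : ∀ α β → 1ℚ * α * 1ℚ ≡ 1ℚ * ((α - β) + 1ℚ * β)
  unit = solve 2 (λ α β → con 1ℚ :* α :* con 1ℚ := con 1ℚ :* ((α :- β) :+ con 1ℚ :* β)) refl
det-diagOffDiag (suc n) α β = begin
  det (suc (suc n)) (diagOffDiag α β)                                                  ≡⟨ laplace (suc n) (diagOffDiag α β) ⟩
  1ℚ * α * det (suc n) (diagOffDiag α β)
    + Σℚ (suc n) (λ j → sign (suc j) * β * det (suc n) (minor (diagOffDiag α β) (suc j)))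
    ≡⟨ cong₂ _+_ (cong (_*_ (1ℚ * α)) (det-diagOffDiag n α β))
                 (trans (Σ-cong {suc n} λ j → cong (_*_ (sign (suc j) * β)) (det-cong (minor-diagOffDiag α β j)))
                        (offMinor-cofactors n α β)) ⟩
  1ℚ * α * (p * ((α - β) + k * β)) + - (k * (β * β * p))                               ≡⟨ expand α β p k ⟩
  (α - β) * p * ((α - β) + (1ℚ + k) * β)                                               ≡⟨ cong (λ k′ → (α - β) * p * ((α - β) + k′ * β)) (ℕ→ℚ-suc (suc n)) ⟨
  (α - β) ^ suc n * ((α - β) + ℕ→ℚ (suc (suc n)) * β)                                  ∎
  where
  open ≡-Reasoning
  p = (α - β) ^ n
  k = ℕ→ℚ (suc n)
  expand : ∀ α β p k → 1ℚ * α * (p * ((α - β) + k * β)) + - (k * (β * β * p)) ≡ (α - β) * p * ((α - β) + (1ℚ + k) * β)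
  expand = solve 4 (λ α β p k → con 1ℚ :* α :* (p :* ((α :- β) :+ k :* β)) :+ :- (k :* (β :* β :* p)) := (α :- β) :* p :* ((α :- β) :+ (con 1ℚ :+ k) :* β)) refl

det-offMinor zero    α β zero    = refl
det-offMinor (suc n) α β zero    = begin
  det (suc (suc n)) (offMinor α β zero)                                               ≡⟨ laplace (suc n) (offMinor α β zero) ⟩
  1ℚ * β * det (suc n) (diagOffDiag α β)
    + Σℚ (suc n) (λ j → sign (suc j) * β * det (suc n) (minor (offMinor α β zero) (suc j)))
    ≡⟨ cong₂ _+_ (cong (_*_ (1ℚ * β)) (det-diagOffDiag n α β))
                 (trans (Σ-cong {suc n} λ j → cong (_*_ (sign (suc j) * β)) (det-cong (minor-offMinor j)))
                        (offMinor-cofactors n α β)) ⟩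
  1ℚ * β * (p * ((α - β) + k * β)) + - (k * (β * β * p))                              ≡⟨ expand α β p k ⟩
  1ℚ * β * (α - β) ^ suc n                                                            ∎
  where
  open ≡-Reasoning
  p = (α - β) ^ n
  k = ℕ→ℚ (suc n)
  minor-offMinor : ∀ r i j → minor (offMinor α β zero) (suc r) i j ≡ offMinor α β r i j
  minor-offMinor r i zero    = refl
  minor-offMinor r i (suc j) = refl
  expand : ∀ α β p k → 1ℚ * β * (p * ((α - β) + k * β)) + - (k * (β * β * p)) ≡ 1ℚ * β * ((α - β) * p)
  expand = solve 4 (λ α β p k → con 1ℚ :* β :* (p :* ((α :- β) :+ k :* β)) :+ :- (k :* (β :* β :* p)) := con 1ℚ :* β :* ((α :- β) :* p)) refl
det-offMinor (suc n) α β (suc r) = begin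
  det (suc (suc n)) M                                                                  ≡⟨ laplace (suc n) M ⟩
  1ℚ * β * det (suc n) (minor M zero) + (- 1ℚ * α * det (suc n) (minor M (suc zero)) + cofactors₂ n M)
    ≡⟨ cong₂ (λ d₀ d₁ → 1ℚ * β * d₀ + (- 1ℚ * α * d₁ + cofactors₂ n M)) (det-minor minor₀) (det-minor minor₁) ⟩
  1ℚ * β * D + (- 1ℚ * α * D + cofactors₂ n M)
    ≡⟨ cong (λ t → 1ℚ * β * D + (- 1ℚ * α * D + t)) (col₀≡col₁⇒cofactors₂≡0 n M (λ _ → refl)) ⟩
  1ℚ * β * D + (- 1ℚ * α * D + 0ℚ)                                                    ≡⟨ expand α β (sign r) p ⟩
  - sign r * β * (α - β) ^ suc n                                                       ∎
  where
  open ≡-Reasoning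
  M = offMinor α β (suc r)
  p = (α - β) ^ n
  D = sign r * β * p
  det-minor : ∀ {N} → (∀ i j → N i j ≡ offMinor α β r i j) → det (suc n) N ≡ D
  det-minor N≗ = trans (det-cong N≗) (det-offMinor n α β r)
  minor₀ : ∀ i j → minor M zero i j ≡ offMinor α β r i j
  minor₀ i zero    = refl
  minor₀ i (suc j) = refl
  minor₁ : ∀ i j → minor M (suc zero) i j ≡ offMinor α β r i j
  minor₁ i zero    = refl
  minor₁ i (suc j) = refl
  expand : ∀ α β s p → 1ℚ * β * (s * β * p) + (- 1ℚ * α * (s * β * p) + 0ℚ) ≡ - s * β * ((α - β) * p)
  expand = solve 4 (λ α β s p → con 1ℚ :* β :* (s :* β :* p) :+ (:- con 1ℚ :* α :* (s :* β :* p) :+ con 0ℚ) := :- s :* β :* ((α :- β) :* p)) refl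

-- Characteristic polynomials and spectra

charMatrix : ∀ {n} → Matrix n → ℚ → Matrix n
charMatrix M x i j = (if eqFin i j then x else 0ℚ) - M i j

charPolyAt≡det-charMatrix : ∀ {n} (M : Matrix n) x → charPolyAt M x ≡ det n (charMatrix M x)

private
  -- The left-hand side, an entry of the matrix built by `charPolyAt` with its local `if'`,
  -- cannot be written here; it is inferred from the use below.
  charPolyAt-entry : ∀ {n} (M : Matrix n) x i j → _ ≡ charMatrix M x i j

charPolyAt≡det-charMatrix M x = det-cong (charPolyAt-entry M x)

charPolyAt-entry M x i j with eqFin i j
... | true  = refl
... | false = refl

charPolyAt-cong : ∀ {n} {M N : Matrix n} → (∀ i j → M i j ≡ N i j) → ∀ x → charPolyAt M x ≡ charPolyAt N x
charPolyAt-cong {M = M} {N} M≗N x = begin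
  charPolyAt M x          ≡⟨ charPolyAt≡det-charMatrix M x ⟩
  det _ (charMatrix M x)  ≡⟨ det-cong (λ i j → cong (_-_ (if eqFin i j then x else 0ℚ)) (M≗N i j)) ⟩
  det _ (charMatrix N x)  ≡⟨ charPolyAt≡det-charMatrix N x ⟨
  charPolyAt N x          ∎
  where open ≡-Reasoning

IsSpectrum-cong : ∀ {n} {M N : Matrix n} {ls} → (∀ i j → M i j ≡ N i j) → IsSpectrum N ls → IsSpectrum M ls
IsSpectrum-cong M≗N spec x = trans (charPolyAt-cong M≗N x) (spec x)

IsSpectrum-⊕ : ∀ {n} a (M : Matrix n) {ls} → IsSpectrum M ls → IsSpectrum (a ⊕ M) (a ∷ ls)
IsSpectrum-⊕ {n} a M {ls} spec x = begin
  charPolyAt (a ⊕ M) x                     ≡⟨ charPolyAt≡det-charMatrix (a ⊕ M) x ⟩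
  det (suc n) (charMatrix (a ⊕ M) x)       ≡⟨ det-cong {suc n} block ⟩
  det (suc n) ((x - a) ⊕ charMatrix M x)   ≡⟨ det-⊕ n (x - a) (charMatrix M x) ⟩
  (x - a) * det n (charMatrix M x)         ≡⟨ cong (_*_ (x - a)) (trans (sym (charPolyAt≡det-charMatrix M x)) (spec x)) ⟩
  (x - a) * prodℚ (map (λ σ → x - σ) ls)  ∎
  where
  open ≡-Reasoning
  block : ∀ i j → charMatrix (a ⊕ M) x i j ≡ ((x - a) ⊕ charMatrix M x) i j
  block zero    zero    = refl
  block zero    (suc j) = refl
  block (suc i) zero    = refl
  block (suc i) (suc j) = refl

prodℚ-replicate : ∀ (f : ℚ → ℚ) n v → prodℚ (map f (replicate n v)) ≡ f v ^ n
prodℚ-replicate f n v = cong prodℚ (map-replicate f n v)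

IsSpectrum-diagOffDiag : ∀ n d c → IsSpectrum (diagOffDiag {suc n} d c) ((d + ℕ→ℚ n * c) ∷ replicate n (d - c))
IsSpectrum-diagOffDiag n d c x = begin
  charPolyAt (diagOffDiag {suc n} d c) x                                 ≡⟨ charPolyAt≡det-charMatrix (diagOffDiag {suc n} d c) x ⟩
  det (suc n) (charMatrix (diagOffDiag d c) x)                           ≡⟨ det-cong {suc n} entry ⟩
  det (suc n) (diagOffDiag (x - d) (0ℚ - c))                             ≡⟨ det-diagOffDiag n (x - d) (0ℚ - c) ⟩
  (x - d - (0ℚ - c)) ^ n * ((x - d - (0ℚ - c)) + ℕ→ℚ (suc n) * (0ℚ - c))
    ≡⟨ cong₂ (λ y k → y ^ n * ((x - d - (0ℚ - c)) + k * (0ℚ - c))) (shift-root x d c) (ℕ→ℚ-suc n) ⟩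
  (x - (d - c)) ^ n * ((x - d - (0ℚ - c)) + (1ℚ + ℕ→ℚ n) * (0ℚ - c))    ≡⟨ top-root x d c (ℕ→ℚ n) _ ⟩
  (x - (d + ℕ→ℚ n * c)) * (x - (d - c)) ^ n                              ≡⟨ cong (_*_ (x - (d + ℕ→ℚ n * c))) (prodℚ-replicate (λ σ → x - σ) n (d - c)) ⟨
  (x - (d + ℕ→ℚ n * c)) * prodℚ (map (λ σ → x - σ) (replicate n (d - c)))  ∎
  where
  open ≡-Reasoning
  entry : ∀ i j → charMatrix (diagOffDiag d c) x i j ≡ diagOffDiag (x - d) (0ℚ - c) i j
  entry i j with eqFin i j
  ... | true  = refl
  ... | false = refl
  shift-root : ∀ x d c → x - d - (0ℚ - c) ≡ x - (d - c)
  shift-root = solve 3 (λ x d c → x :- d :- (con 0ℚ :- c) := x :- (d :- c)) refl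
  top-root : ∀ x d c k P → P * ((x - d - (0ℚ - c)) + (1ℚ + k) * (0ℚ - c)) ≡ (x - (d + k * c)) * P
  top-root = solve 5 (λ x d c k P → P :* ((x :- d :- (con 0ℚ :- c)) :+ (con 1ℚ :+ k) :* (con 0ℚ :- c)) := (x :- (d :+ k :* c)) :* P) refl

-- Uniqueness of spectra

rootProduct : List ℚ → ℚ → ℚ
rootProduct ls x = prodℚ (map (λ σ → x - σ) ls)

Poly : Set
Poly = List ℚ

eval : Poly → ℚ → ℚ
eval []       x = 0ℚ
eval (c ∷ cs) x = c + x * eval cs x

infixl 6 _+ₚ_
_+ₚ_ : Poly → Poly → Poly
[]      +ₚ q       = q
(a ∷ p) +ₚ []      = a ∷ p
(a ∷ p) +ₚ (b ∷ q) = (a + b) ∷ (p +ₚ q)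

infixr 7 _·ₚ_
_·ₚ_ : ℚ → Poly → Poly
c ·ₚ p = map (_*_ c) p

eval-+ₚ : ∀ p q x → eval (p +ₚ q) x ≡ eval p x + eval q x
eval-+ₚ []      q       x = sym (ℚ.+-identityˡ _)
eval-+ₚ (a ∷ p) []      x = sym (ℚ.+-identityʳ _)
eval-+ₚ (a ∷ p) (b ∷ q) x = trans (cong (λ t → (a + b) + x * t) (eval-+ₚ p q x)) (regroup a b x (eval p x) (eval q x))
  where
  regroup : ∀ a b x s t → (a + b) + x * (s + t) ≡ (a + x * s) + (b + x * t)
  regroup = solve 5 (λ a b x s t → (a :+ b) :+ x :* (s :+ t) := (a :+ x :* s) :+ (b :+ x :* t)) refl

eval-·ₚ : ∀ c p x → eval (c ·ₚ p) x ≡ c * eval p x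
eval-·ₚ c []      x = sym (ℚ.*-zeroʳ c)
eval-·ₚ c (a ∷ p) x = trans (cong (λ t → c * a + x * t) (eval-·ₚ c p x)) (regroup c a x (eval p x))
  where
  regroup : ∀ c a x s → c * a + x * (c * s) ≡ c * (a + x * s)
  regroup = solve 4 (λ c a x s → c :* a :+ x :* (c :* s) := c :* (a :+ x :* s)) refl

rootPoly : List ℚ → Poly
rootPoly []       = 1ℚ ∷ []
rootPoly (σ ∷ ls) = (0ℚ ∷ rootPoly ls) +ₚ (- σ) ·ₚ rootPoly ls

eval-rootPoly : ∀ ls x → eval (rootPoly ls) x ≡ rootProduct ls x
eval-rootPoly []       x = unit x
  where
  unit : ∀ x → 1ℚ + x * 0ℚ ≡ 1ℚ
  unit = solve 1 (λ x → con 1ℚ :+ x :* con 0ℚ := con 1ℚ) refl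
eval-rootPoly (σ ∷ ls) x = begin
  eval ((0ℚ ∷ rootPoly ls) +ₚ (- σ) ·ₚ rootPoly ls) x   ≡⟨ eval-+ₚ (0ℚ ∷ rootPoly ls) ((- σ) ·ₚ rootPoly ls) x ⟩
  (0ℚ + x * eval (rootPoly ls) x) + eval ((- σ) ·ₚ rootPoly ls) x
    ≡⟨ cong₂ (λ s t → (0ℚ + x * s) + t) (eval-rootPoly ls x) (trans (eval-·ₚ (- σ) (rootPoly ls) x) (cong (_*_ (- σ)) (eval-rootPoly ls x))) ⟩
  (0ℚ + x * rootProduct ls x) + - σ * rootProduct ls x  ≡⟨ factor x σ (rootProduct ls x) ⟩
  (x - σ) * rootProduct ls x                            ∎
  where
  open ≡-Reasoning
  factor : ∀ x σ P → (0ℚ + x * P) + - σ * P ≡ (x - σ) * P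
  factor = solve 3 (λ x σ P → (con 0ℚ :+ x :* P) :+ :- σ :* P := (x :- σ) :* P) refl

divide : ℚ → Poly → Poly
divide a []           = []
divide a (c ∷ [])     = []
divide a (c ∷ d ∷ ds) = eval (d ∷ ds) a ∷ divide a (d ∷ ds)

length-divide : ∀ a c cs → length (divide a (c ∷ cs)) ≡ length cs
length-divide a c []       = refl
length-divide a c (d ∷ ds) = cong suc (length-divide a d ds)

eval-divide : ∀ a p x → eval p x ≡ eval p a + (x - a) * eval (divide a p) x
eval-divide a []           x = zero-case x a
  where
  zero-case : ∀ x a → 0ℚ ≡ 0ℚ + (x - a) * 0ℚ
  zero-case = solve 2 (λ x a → con 0ℚ := con 0ℚ :+ (x :- a) :* con 0ℚ) refl
eval-divide a (c ∷ [])     x = const-case c x a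
  where
  const-case : ∀ c x a → c + x * 0ℚ ≡ (c + a * 0ℚ) + (x - a) * 0ℚ
  const-case = solve 3 (λ c x a → c :+ x :* con 0ℚ := (c :+ a :* con 0ℚ) :+ (x :- a) :* con 0ℚ) refl
eval-divide a (c ∷ d ∷ ds) x =
  trans (cong (λ t → c + x * t) (eval-divide a (d ∷ ds) x)) (horner c x a (eval (d ∷ ds) a) (eval (divide a (d ∷ ds)) x))
  where
  horner : ∀ c x a e q → c + x * (e + (x - a) * q) ≡ (c + a * e) + (x - a) * (e + x * q)
  horner = solve 5 (λ c x a e q → c :+ x :* (e :+ (x :- a) :* q) := (c :+ a :* e) :+ (x :- a) :* (e :+ x :* q)) refl

*-cancelˡ-≢0 : ∀ {p q r} → p ≢ 0ℚ → p * q ≡ p * r → q ≡ r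
*-cancelˡ-≢0 {p} {q} {r} p≢0 pq≡pr = begin
  q                ≡⟨ ℚ.*-identityˡ q ⟨
  1ℚ * q           ≡⟨ cong (_* q) (ℚ.*-inverseˡ p) ⟨
  1/ p * p * q     ≡⟨ ℚ.*-assoc (1/ p) p q ⟩
  1/ p * (p * q)   ≡⟨ cong (_*_ (1/ p)) pq≡pr ⟩
  1/ p * (p * r)   ≡⟨ ℚ.*-assoc (1/ p) p r ⟨
  1/ p * p * r     ≡⟨ cong (_* r) (ℚ.*-inverseˡ p) ⟩
  1ℚ * r           ≡⟨ ℚ.*-identityˡ r ⟩
  r                ∎
  where
  open ≡-Reasoning
  instance _ = ℚ.≢-nonZero p≢0

<⇒-≢0 : ∀ {p q} → p < q → q - p ≢ 0ℚ
<⇒-≢0 p<q q-p≡0 = ℚ.<⇒≢ p<q (sym (x∙y⁻¹≈ε⇒x≈y _ _ q-p≡0))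

<+1 : ∀ p → p < p + 1ℚ
<+1 p = subst (_< p + 1ℚ) (ℚ.+-identityʳ p) (ℚ.+-monoʳ-< p (ℚ.positive⁻¹ 1ℚ))

vanishing-above⇒≡0 : ∀ n p → length p ≡ n → ∀ N → (∀ x → N < x → eval p x ≡ 0ℚ) → ∀ x → eval p x ≡ 0ℚ
vanishing-above⇒≡0 zero    []       _   N _    x = refl
vanishing-above⇒≡0 (suc n) (c ∷ cs) len N p≡0 x = begin
  eval (c ∷ cs) x                  ≡⟨ eval-divide a (c ∷ cs) x ⟩
  eval (c ∷ cs) a + (x - a) * eval q x
    ≡⟨ cong₂ (λ s t → s + (x - a) * t) (p≡0 a (<+1 N)) (vanishing-above⇒≡0 n q len-q a q≡0 x) ⟩
  0ℚ + (x - a) * 0ℚ                ≡⟨ collapse x a ⟩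
  0ℚ                               ∎
  where
  open ≡-Reasoning
  a = N + 1ℚ
  q = divide a (c ∷ cs)
  len-q : length q ≡ n
  len-q = trans (length-divide a c cs) (ℕ.suc-injective len)
  collapse : ∀ x a → 0ℚ + (x - a) * 0ℚ ≡ 0ℚ
  collapse = solve 2 (λ x a → con 0ℚ :+ (x :- a) :* con 0ℚ := con 0ℚ) refl
  q≡0 : ∀ y → a < y → eval q y ≡ 0ℚ
  q≡0 y a<y = *-cancelˡ-≢0 (<⇒-≢0 a<y) (begin
    (y - a) * eval q y                    ≡⟨ ℚ.+-identityˡ _ ⟨
    0ℚ + (y - a) * eval q y               ≡⟨ cong (λ s → s + (y - a) * eval q y) (p≡0 a (<+1 N)) ⟨
    eval (c ∷ cs) a + (y - a) * eval q y  ≡⟨ eval-divide a (c ∷ cs) y ⟨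
    eval (c ∷ cs) y                       ≡⟨ p≡0 y (ℚ.<-trans (<+1 N) a<y) ⟩
    0ℚ                                    ≡⟨ ℚ.*-zeroʳ (y - a) ⟨
    (y - a) * 0ℚ                          ∎)

rootProducts-agree-above : ∀ A B N → (∀ x → N < x → rootProduct A x ≡ rootProduct B x) → ∀ x → rootProduct A x ≡ rootProduct B x
rootProducts-agree-above A B N agree x = x∙y⁻¹≈ε⇒x≈y _ _ (trans (sym (eval-D x)) (vanishing-above⇒≡0 _ D refl N D≡0 x))
  where
  D = rootPoly A +ₚ (- 1ℚ) ·ₚ rootPoly B
  as-difference : ∀ a b → a + - 1ℚ * b ≡ a - b
  as-difference = solve 2 (λ a b → a :+ :- con 1ℚ :* b := a :- b) refl
  eval-D : ∀ x → eval D x ≡ rootProduct A x - rootProduct B x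
  eval-D x = trans (eval-+ₚ (rootPoly A) ((- 1ℚ) ·ₚ rootPoly B) x)
    (trans (cong₂ _+_ (eval-rootPoly A x) (trans (eval-·ₚ (- 1ℚ) (rootPoly B) x) (cong (_*_ (- 1ℚ)) (eval-rootPoly B x))))
           (as-difference (rootProduct A x) (rootProduct B x)))
  D≡0 : ∀ x → N < x → eval D x ≡ 0ℚ
  D≡0 x N<x = trans (eval-D x) (trans (cong (_- rootProduct B x) (agree x N<x)) (ℚ.+-inverseʳ (rootProduct B x)))

rootProduct-root : ∀ σ ls → rootProduct (σ ∷ ls) σ ≡ 0ℚ
rootProduct-root σ ls = trans (cong (_* rootProduct ls σ) (ℚ.+-inverseʳ σ)) (ℚ.*-zeroˡ (rootProduct ls σ))

root⇒∈ : ∀ σ ls → rootProduct ls σ ≡ 0ℚ → σ ∈ ls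
root⇒∈ σ []       ()
root⇒∈ σ (τ ∷ ls) root with σ ℚ.≟ τ
... | yes σ≡τ = here σ≡τ
... | no  σ≢τ = there (root⇒∈ σ ls (*-cancelˡ-≢0 σ-τ≢0 (trans root (sym (ℚ.*-zeroʳ (σ - τ))))))
  where
  σ-τ≢0 : σ - τ ≢ 0ℚ
  σ-τ≢0 σ-τ≡0 = σ≢τ (x∙y⁻¹≈ε⇒x≈y σ τ σ-τ≡0)

rootProduct-↭ : ∀ {A B} → A ↭ B → ∀ x → rootProduct A x ≡ rootProduct B x
rootProduct-↭ A↭B x = foldr-commMonoid (setoid ℚ) ℚ.*-1-isCommutativeMonoid (↭⇒↭ₛ (map⁺ (λ σ → x - σ) A↭B))

rootProduct-injective : ∀ A B → (∀ x → rootProduct A x ≡ rootProduct B x) → A ↭ B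
rootProduct-injective []      []      _     = ↭-refl
rootProduct-injective []      (τ ∷ B) A≗B   with () ← trans (A≗B τ) (rootProduct-root τ B)
rootProduct-injective (σ ∷ A) B       A≗B
  with ys , zs , refl ← ∈-∃++ (root⇒∈ σ B (trans (sym (A≗B σ)) (rootProduct-root σ A)))
  = ↭-trans (↭-prep σ (rootProduct-injective A (ys ++ zs) A≗B′)) (↭-sym (shift σ ys zs))
  where
  A≗B′ : ∀ x → rootProduct A x ≡ rootProduct (ys ++ zs) x
  A≗B′ = rootProducts-agree-above A (ys ++ zs) σ λ x σ<x →
    *-cancelˡ-≢0 (<⇒-≢0 σ<x) (trans (A≗B x) (rootProduct-↭ (shift σ ys zs) x))

sumℚ-↭ : ∀ {A B} → A ↭ B → sumℚ A ≡ sumℚ B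
sumℚ-↭ A↭B = foldr-commMonoid (setoid ℚ) ℚ.+-0-isCommutativeMonoid (↭⇒↭ₛ A↭B)

LEPlusCN≡-unique : ∀ {n} (G : Graph (suc n)) {a b} → LEPlusCN≡ G a → LEPlusCN≡ G b → a ≡ b
LEPlusCN≡-unique G {a} {b} (A , A-spec , LE≡a) (B , B-spec , LE≡b) = begin
  a           ≡⟨ LE≡a ⟨
  LEfrom G A  ≡⟨ sumℚ-↭ (map⁺ _ (rootProduct-injective A B λ x → trans (sym (A-spec x)) (B-spec x))) ⟩
  LEfrom G B  ≡⟨ LE≡b ⟩
  b           ∎
  where open ≡-Reasoning

-- Common-neighbourhood matrices and their energies

eqFin-refl : ∀ {n} (i : Fin n) → eqFin i i ≡ true
eqFin-refl zero    = refl
eqFin-refl (suc i) = eqFin-refl i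

CNSL≡ : ∀ {p} (G : Graph p) i j → CNSL G i j ≡ (if eqFin i j then Σℚ p (CN G i) else commonNbrs G i j)
CNSL≡ G i j with eqFin i j
... | true  = ℚ.+-identityʳ _
... | false = ℚ.+-identityˡ _

trace-CNRS : ∀ {p} (G : Graph p) → trace (CNRS G) ≡ Σℚ p (λ i → Σℚ p (CN G i))
trace-CNRS G = Σ-cong diagonal
  where
  diagonal : ∀ i → CNRS G i i ≡ Σℚ _ (CN G i)
  diagonal i with eqFin i i | eqFin-refl i
  ... | true | _ = refl

commonNbrs≡0 : ∀ {p} (G : Graph p) i j → (∀ w → (adj G i w ∧ adj G j w) ≡ false) → commonNbrs G i j ≡ 0ℚ
commonNbrs≡0 G i j disjoint = Σ-zero λ w → cong b2q (disjoint w)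

adj-complete : ∀ {p} (i j : Fin p) → adj (complete p) i j ≡ not (eqFin i j)
adj-complete i j with eqFin i j
... | true  = refl
... | false = refl

count-≢ : ∀ q (j : Fin (suc q)) → Σℚ (suc q) (λ w → b2q (not (eqFin j w))) ≡ ℕ→ℚ q
count-≢ q j = begin
  Σℚ (suc q) (λ w → b2q (not (eqFin j w)))         ≡⟨ Σ-cong (λ w → b2q-not (eqFin j w)) ⟩
  Σℚ (suc q) (λ w → if eqFin j w then 0ℚ else 1ℚ)  ≡⟨ Σ-δ q j 0ℚ 1ℚ ⟩
  0ℚ + ℕ→ℚ q * 1ℚ                                  ≡⟨ simplify (ℕ→ℚ q) ⟩
  ℕ→ℚ q                                            ∎
  where
  open ≡-Reasoning
  b2q-not : ∀ b → b2q (not b) ≡ (if b then 0ℚ else 1ℚ)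
  b2q-not true  = refl
  b2q-not false = refl
  simplify : ∀ s → 0ℚ + s * 1ℚ ≡ s
  simplify = solve 1 (λ s → con 0ℚ :+ s :* con 1ℚ := s) refl

count-≢₂ : ∀ q (i j : Fin (suc (suc q))) → eqFin i j ≡ false →
           Σℚ (suc (suc q)) (λ w → b2q (not (eqFin i w) ∧ not (eqFin j w))) ≡ ℕ→ℚ q
count-≢₂ q       zero       zero       ()
count-≢₂ q       zero       (suc j)    _   = trans (ℚ.+-identityˡ _) (count-≢ q j)
count-≢₂ q       (suc i)    zero       _   =
  trans (ℚ.+-identityˡ _) (trans (Σ-cong λ w → cong b2q (∧-identityʳ (not (eqFin i w)))) (count-≢ q i))
count-≢₂ zero    (suc zero) (suc zero) ()
count-≢₂ (suc q) (suc i)    (suc j)    i≢j = trans (cong (_+_ 1ℚ) (count-≢₂ q i j i≢j)) (sym (ℕ→ℚ-suc q))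

nonNeg-* : ∀ {p q} → 0ℚ ≤ p → 0ℚ ≤ q → 0ℚ ≤ p * q
nonNeg-* {p} {q} p≥0 q≥0 = ℚ.nonNegative⁻¹ _ {{ℚ.nonNeg*nonNeg⇒nonNeg p {{ℚ.nonNegative p≥0}} q {{ℚ.nonNegative q≥0}}}}

∣∣≡-nonNeg : ∀ {q r} → 0ℚ ≤ r → q ≡ r → ∣ q ∣ ≡ r
∣∣≡-nonNeg r≥0 refl = ℚ.0≤p⇒∣p∣≡p r≥0

∣∣≡-neg : ∀ {q r} → 0ℚ ≤ r → q ≡ - r → ∣ q ∣ ≡ r
∣∣≡-neg {r = r} r≥0 refl = trans (ℚ.∣-p∣≡∣p∣ r) (∣∣≡-nonNeg r≥0 refl)

∣-∣-rescale : ∀ {p w} → p * w ≡ 1ℚ → 0ℚ ≤ w → ∀ t σ → ∣ σ - t * w ∣ ≡ ∣ p * σ - t ∣ * w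
∣-∣-rescale {p} {w} p*w≡1 w≥0 t σ = begin
  ∣ σ - t * w ∣                ≡⟨ cong (λ u → ∣ u - t * w ∣) (ℚ.*-identityʳ σ) ⟨
  ∣ σ * 1ℚ - t * w ∣           ≡⟨ cong (λ u → ∣ σ * u - t * w ∣) p*w≡1 ⟨
  ∣ σ * (p * w) - t * w ∣      ≡⟨ cong ∣_∣ (factor σ t p w) ⟩
  ∣ (p * σ - t) * w ∣          ≡⟨ ℚ.∣p*q∣≡∣p∣*∣q∣ (p * σ - t) w ⟩
  ∣ p * σ - t ∣ * ∣ w ∣        ≡⟨ cong (_*_ ∣ p * σ - t ∣) (∣∣≡-nonNeg w≥0 refl) ⟩
  ∣ p * σ - t ∣ * w            ∎
  where
  open ≡-Reasoning
  factor : ∀ σ t p w → σ * (p * w) - t * w ≡ (p * σ - t) * w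
  factor = solve 4 (λ σ t p w → σ :* (p :* w) :- t :* w := (p :* σ :- t) :* w) refl

sumℚ-replicate : ∀ (f : ℚ → ℚ) n v → sumℚ (map f (replicate n v)) ≡ ℕ→ℚ n * f v
sumℚ-replicate f zero    v = sym (ℚ.*-zeroˡ (f v))
sumℚ-replicate f (suc n) v = begin
  f v + sumℚ (map f (replicate n v))  ≡⟨ cong (_+_ (f v)) (sumℚ-replicate f n v) ⟩
  f v + ℕ→ℚ n * f v                   ≡⟨ step (f v) (ℕ→ℚ n) ⟩
  (1ℚ + ℕ→ℚ n) * f v                  ≡⟨ cong (_* f v) (ℕ→ℚ-suc n) ⟨
  ℕ→ℚ (suc n) * f v                   ∎
  where
  open ≡-Reasoning
  step : ∀ a s → a + s * a ≡ (1ℚ + s) * a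
  step = solve 2 (λ a s → a :+ s :* a := (con 1ℚ :+ s) :* a) refl

LEfrom-rescaled : ∀ {n} (G : Graph (suc n)) {t} → trace (CNRS G) ≡ t → ∀ ls →
                  LEfrom G ls ≡ sumℚ (map (λ σ → ∣ ℕ→ℚ (suc n) * σ - t ∣ * (+ 1 / suc n)) ls)
LEfrom-rescaled {n} G {t} trace≡t ls =
  trans (cong (λ T → sumℚ (map (λ σ → ∣ σ - T * (+ 1 / suc n) ∣) ls)) trace≡t)
        (cong sumℚ (map-cong (∣-∣-rescale {ℕ→ℚ (suc n)} (ℕ→ℚ-*-inverse n) (1/suc-nonNeg n) t) ls))

module Star (m : ℕ) where

  S : Graph (suc (suc m))
  S = star (suc m)

  commonNbrs-centre-leaf : ∀ j → commonNbrs S zero (suc j) ≡ 0ℚ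
  commonNbrs-centre-leaf j = commonNbrs≡0 S zero (suc j) λ { zero → refl ; (suc _) → refl }

  commonNbrs-leaf-centre : ∀ i → commonNbrs S (suc i) zero ≡ 0ℚ
  commonNbrs-leaf-centre i = commonNbrs≡0 S (suc i) zero λ { zero → refl ; (suc _) → refl }

  commonNbrs-leaves : ∀ i j → commonNbrs S (suc i) (suc j) ≡ 1ℚ
  commonNbrs-leaves i j = cong (_+_ 1ℚ) (Σ-zero {suc m} {λ _ → 0ℚ} λ _ → refl)

  CN-leaves : ∀ i j → CN S (suc i) (suc j) ≡ (if eqFin i j then 0ℚ else 1ℚ)
  CN-leaves i j with eqFin i j
  ... | true  = refl
  ... | false = commonNbrs-leaves i j

  rowSum-centre : Σℚ (suc (suc m)) (CN S zero) ≡ 0ℚ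
  rowSum-centre = Σ-zero {f = CN S zero} λ { zero → refl ; (suc j) → commonNbrs-centre-leaf j }

  rowSum-leaf : ∀ i → Σℚ (suc (suc m)) (CN S (suc i)) ≡ ℕ→ℚ m
  rowSum-leaf i = begin
    CN S (suc i) zero + Σℚ (suc m) (λ j → CN S (suc i) (suc j))  ≡⟨ cong₂ _+_ (commonNbrs-leaf-centre i) (Σ-cong (CN-leaves i)) ⟩
    0ℚ + Σℚ (suc m) (λ j → if eqFin i j then 0ℚ else 1ℚ)         ≡⟨ cong (_+_ 0ℚ) (Σ-δ m i 0ℚ 1ℚ) ⟩
    0ℚ + (0ℚ + ℕ→ℚ m * 1ℚ)                                       ≡⟨ simplify (ℕ→ℚ m) ⟩
    ℕ→ℚ m                                                        ∎
    where
    open ≡-Reasoning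
    simplify : ∀ s → 0ℚ + (0ℚ + s * 1ℚ) ≡ s
    simplify = solve 1 (λ s → con 0ℚ :+ (con 0ℚ :+ s :* con 1ℚ) := s) refl

  CNSL-star : ∀ i j → CNSL S i j ≡ (0ℚ ⊕ diagOffDiag (ℕ→ℚ m) 1ℚ) i j
  CNSL-star zero    zero    = trans (CNSL≡ S zero zero) rowSum-centre
  CNSL-star zero    (suc j) = trans (CNSL≡ S zero (suc j)) (commonNbrs-centre-leaf j)
  CNSL-star (suc i) zero    = trans (CNSL≡ S (suc i) zero) (commonNbrs-leaf-centre i)
  CNSL-star (suc i) (suc j) =
    trans (CNSL≡ S (suc i) (suc j)) (cong₂ (if_then_else_ (eqFin i j)) (rowSum-leaf i) (commonNbrs-leaves i j))

  trace-star : trace (CNRS S) ≡ ℕ→ℚ (suc m) * ℕ→ℚ m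
  trace-star = begin
    trace (CNRS S)                                                                       ≡⟨ trace-CNRS S ⟩
    Σℚ (suc (suc m)) (CN S zero) + Σℚ (suc m) (λ i → Σℚ (suc (suc m)) (CN S (suc i)))
      ≡⟨ cong₂ _+_ rowSum-centre (trans (Σ-cong rowSum-leaf) (Σ-const (suc m) (ℕ→ℚ m))) ⟩
    0ℚ + ℕ→ℚ (suc m) * ℕ→ℚ m                                                             ≡⟨ ℚ.+-identityˡ _ ⟩
    ℕ→ℚ (suc m) * ℕ→ℚ m                                                                  ∎
    where open ≡-Reasoning

  leafSpectrum : List ℚ
  leafSpectrum = (ℕ→ℚ m + ℕ→ℚ m * 1ℚ) ∷ replicate m (ℕ→ℚ m - 1ℚ)

  IsSpectrum-star : IsSpectrum (CNSL S) (0ℚ ∷ leafSpectrum)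
  IsSpectrum-star = IsSpectrum-cong {ls = 0ℚ ∷ leafSpectrum} CNSL-star
    (IsSpectrum-⊕ 0ℚ (diagOffDiag {suc m} (ℕ→ℚ m) 1ℚ) {ls = leafSpectrum} (IsSpectrum-diagOffDiag m (ℕ→ℚ m) 1ℚ))

  private
    s p t w : ℚ
    s = ℕ→ℚ m
    p = ℕ→ℚ (suc (suc m))
    t = ℕ→ℚ (suc m) * s
    w = + 1 / suc (suc m)

    p≡ : p ≡ ℕ→ℚ 2 + s
    p≡ = ℕ→ℚ-homo-+ 2 m

    t≡ : t ≡ (1ℚ + s) * s
    t≡ = cong (_* s) (ℕ→ℚ-suc m)

    abs-centre : ∣ p * 0ℚ - t ∣ ≡ t
    abs-centre = ∣∣≡-neg (nonNeg-* (ℕ→ℚ-nonNeg (suc m)) (ℕ→ℚ-nonNeg m)) (eq p t)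
      where
      eq : ∀ p t → p * 0ℚ - t ≡ - t
      eq = solve 2 (λ p t → p :* con 0ℚ :- t := :- t) refl

    abs-top : ∣ p * (s + s * 1ℚ) - t ∣ ≡ s * ℕ→ℚ (3 ℕ.+ m)
    abs-top = ∣∣≡-nonNeg (nonNeg-* (ℕ→ℚ-nonNeg m) (ℕ→ℚ-nonNeg (3 ℕ.+ m))) (begin
      p * (s + s * 1ℚ) - t                       ≡⟨ cong₂ (λ p t → p * (s + s * 1ℚ) - t) p≡ t≡ ⟩
      (ℕ→ℚ 2 + s) * (s + s * 1ℚ) - (1ℚ + s) * s  ≡⟨ eq s ⟩
      s * (ℕ→ℚ 3 + s)                            ≡⟨ cong (_*_ s) (ℕ→ℚ-homo-+ 3 m) ⟨
      s * ℕ→ℚ (3 ℕ.+ m)                          ∎)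
      where
      open ≡-Reasoning
      eq : ∀ s → (ℕ→ℚ 2 + s) * (s + s * 1ℚ) - (1ℚ + s) * s ≡ s * (ℕ→ℚ 3 + s)
      eq = solve 1 (λ s → (con (ℕ→ℚ 2) :+ s) :* (s :+ s :* con 1ℚ) :- (con 1ℚ :+ s) :* s := s :* (con (ℕ→ℚ 3) :+ s)) refl

    abs-leaf : ∣ p * (s - 1ℚ) - t ∣ ≡ ℕ→ℚ 2
    abs-leaf = ∣∣≡-neg (ℕ→ℚ-nonNeg 2) (trans (cong₂ (λ p t → p * (s - 1ℚ) - t) p≡ t≡) (eq s))
      where
      eq : ∀ s → (ℕ→ℚ 2 + s) * (s - 1ℚ) - (1ℚ + s) * s ≡ - ℕ→ℚ 2
      eq = solve 1 (λ s → (con (ℕ→ℚ 2) :+ s) :* (s :- con 1ℚ) :- (con 1ℚ :+ s) :* s := :- con (ℕ→ℚ 2)) refl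

  energy : ℚ
  energy = ℕ→ℚ (2 ℕ.* m ℕ.* (3 ℕ.+ m)) * w

  LE-star : LEfrom S (0ℚ ∷ leafSpectrum) ≡ energy
  LE-star = begin
    LEfrom S (0ℚ ∷ leafSpectrum)                                  ≡⟨ LEfrom-rescaled S trace-star (0ℚ ∷ leafSpectrum) ⟩
    ∣ p * 0ℚ - t ∣ * w + (∣ p * (s + s * 1ℚ) - t ∣ * w + sumℚ (map g (replicate m (s - 1ℚ))))
      ≡⟨ cong₂ (λ a r → a * w + (∣ p * (s + s * 1ℚ) - t ∣ * w + r)) abs-centre (sumℚ-replicate g m (s - 1ℚ)) ⟩
    t * w + (∣ p * (s + s * 1ℚ) - t ∣ * w + s * (∣ p * (s - 1ℚ) - t ∣ * w))
      ≡⟨ cong₂ (λ a b → t * w + (a * w + s * (b * w))) abs-top abs-leaf ⟩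
    t * w + (s * ℕ→ℚ (3 ℕ.+ m) * w + s * (ℕ→ℚ 2 * w))
      ≡⟨ cong₂ (λ t u → t * w + (s * u * w + s * (ℕ→ℚ 2 * w))) t≡ (ℕ→ℚ-homo-+ 3 m) ⟩
    (1ℚ + s) * s * w + (s * (ℕ→ℚ 3 + s) * w + s * (ℕ→ℚ 2 * w))  ≡⟨ collect s w ⟩
    ℕ→ℚ 2 * s * (ℕ→ℚ 3 + s) * w
      ≡⟨ cong (_* w) (trans (ℕ→ℚ-homo-* (2 ℕ.* m) (3 ℕ.+ m)) (cong₂ _*_ (ℕ→ℚ-homo-* 2 m) (ℕ→ℚ-homo-+ 3 m))) ⟨
    energy                                                        ∎
    where
    open ≡-Reasoning
    g : ℚ → ℚ
    g σ = ∣ p * σ - t ∣ * w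
    collect : ∀ s w → (1ℚ + s) * s * w + (s * (ℕ→ℚ 3 + s) * w + s * (ℕ→ℚ 2 * w)) ≡ ℕ→ℚ 2 * s * (ℕ→ℚ 3 + s) * w
    collect = solve 2 (λ s w → (con 1ℚ :+ s) :* s :* w :+ (s :* (con (ℕ→ℚ 3) :+ s) :* w :+ s :* (con (ℕ→ℚ 2) :* w)) := con (ℕ→ℚ 2) :* s :* (con (ℕ→ℚ 3) :+ s) :* w) refl

  LEPlusCN-star : LEPlusCN≡ S energy
  LEPlusCN-star = 0ℚ ∷ leafSpectrum , IsSpectrum-star , LE-star

  ℤ→ℚ-top : ℤ→ℚ ((+ 2) ℤ.* (+ suc m ℤ.- + 1)) ≡ ℕ→ℚ m + ℕ→ℚ m * 1ℚ
  ℤ→ℚ-top = trans (cong ℤ→ℚ (eq (+ m))) (trans (ℤ→ℚ-homo-+ (+ m) (+ m)) (cong (_+_ s) (sym (ℚ.*-identityʳ s))))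
    where
    eq : ∀ x → + 2 ℤ.* ((+ 1 ℤ.+ x) ℤ.- + 1) ≡ x ℤ.+ x
    eq = ℤ-Ring.solve-∀

  ℤ→ℚ-leaf : ℤ→ℚ (+ suc m ℤ.- + 2) ≡ ℕ→ℚ m - 1ℚ
  ℤ→ℚ-leaf = trans (cong ℤ→ℚ (eq (+ m))) (ℤ→ℚ-homo-+ (+ m) (ℤ.- + 1))
    where
    eq : ∀ x → (+ 1 ℤ.+ x) ℤ.- + 2 ≡ x ℤ.- + 1
    eq = ℤ-Ring.solve-∀

  /≡energy : ((+ 2) ℤ.* (+ suc m ℤ.- + 1) ℤ.* (+ suc m ℤ.+ + 2)) / suc (suc m) ≡ energy
  /≡energy = trans (/-as-* ((+ 2) ℤ.* (+ suc m ℤ.- + 1) ℤ.* (+ suc m ℤ.+ + 2)) (suc m))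
                   (cong (λ z → ℤ→ℚ z * w) (trans (eq (+ m)) (sym pos)))
    where
    eq : ∀ x → + 2 ℤ.* ((+ 1 ℤ.+ x) ℤ.- + 1) ℤ.* ((+ 1 ℤ.+ x) ℤ.+ + 2) ≡ + 2 ℤ.* x ℤ.* (+ 3 ℤ.+ x)
    eq = ℤ-Ring.solve-∀
    pos : + (2 ℕ.* m ℕ.* (3 ℕ.+ m)) ≡ + 2 ℤ.* + m ℤ.* (+ 3 ℤ.+ + m)
    pos = trans (ℤ.pos-* (2 ℕ.* m) (3 ℕ.+ m)) (cong (ℤ._* + (3 ℕ.+ m)) (ℤ.pos-* 2 m))

module Complete (m : ℕ) where

  K : Graph (suc (suc m))
  K = complete (suc (suc m))

  commonNbrs-K : ∀ i j → eqFin i j ≡ false → commonNbrs K i j ≡ ℕ→ℚ m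
  commonNbrs-K i j i≢j = trans (Σ-cong λ w → cong₂ (λ a b → b2q (a ∧ b)) (adj-complete i w) (adj-complete j w)) (count-≢₂ m i j i≢j)

  CN-K : ∀ i j → CN K i j ≡ diagOffDiag 0ℚ (ℕ→ℚ m) i j
  CN-K i j with eqFin i j in i≢j
  ... | true  = refl
  ... | false = commonNbrs-K i j i≢j

  d : ℚ
  d = ℕ→ℚ (suc m) * ℕ→ℚ m

  rowSum-K : ∀ i → Σℚ (suc (suc m)) (CN K i) ≡ d
  rowSum-K i = trans (Σ-cong (CN-K i)) (trans (Σ-δ (suc m) i 0ℚ (ℕ→ℚ m)) (ℚ.+-identityˡ d))

  CNSL-K : ∀ i j → CNSL K i j ≡ diagOffDiag d (ℕ→ℚ m) i j
  CNSL-K i j = trans (CNSL≡ K i j) (entry (eqFin i j) refl)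
    where
    entry : ∀ b → eqFin i j ≡ b → (if b then Σℚ (suc (suc m)) (CN K i) else commonNbrs K i j) ≡ (if b then d else ℕ→ℚ m)
    entry true  _   = rowSum-K i
    entry false i≢j = commonNbrs-K i j i≢j

  trace-K : trace (CNRS K) ≡ ℕ→ℚ (suc (suc m)) * d
  trace-K = trans (trace-CNRS K) (trans (Σ-cong rowSum-K) (Σ-const (suc (suc m)) d))

  spectrum : List ℚ
  spectrum = (d + d) ∷ replicate (suc m) (d - ℕ→ℚ m)

  IsSpectrum-K : IsSpectrum (CNSL K) spectrum
  IsSpectrum-K = IsSpectrum-cong {ls = spectrum} CNSL-K (IsSpectrum-diagOffDiag (suc m) d (ℕ→ℚ m))

  private
    s p w : ℚ
    s = ℕ→ℚ m
    p = ℕ→ℚ (suc (suc m))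
    w = + 1 / suc (suc m)

    d≥0 : 0ℚ ≤ d
    d≥0 = nonNeg-* (ℕ→ℚ-nonNeg (suc m)) (ℕ→ℚ-nonNeg m)

    abs-top : ∣ p * (d + d) - p * d ∣ ≡ p * d
    abs-top = ∣∣≡-nonNeg (nonNeg-* (ℕ→ℚ-nonNeg (suc (suc m))) d≥0) (eq p d)
      where
      eq : ∀ p d → p * (d + d) - p * d ≡ p * d
      eq = solve 2 (λ p d → p :* (d :+ d) :- p :* d := p :* d) refl

    abs-rest : ∣ p * (d - s) - p * d ∣ ≡ p * s
    abs-rest = ∣∣≡-neg (nonNeg-* (ℕ→ℚ-nonNeg (suc (suc m))) (ℕ→ℚ-nonNeg m)) (eq p d s)
      where
      eq : ∀ p d s → p * (d - s) - p * d ≡ - (p * s)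
      eq = solve 3 (λ p d s → p :* (d :- s) :- p :* d := :- (p :* s)) refl

  energy : ℚ
  energy = d + d

  LE-complete : LEfrom K spectrum ≡ energy
  LE-complete = begin
    LEfrom K spectrum                                               ≡⟨ LEfrom-rescaled K trace-K spectrum ⟩
    ∣ p * (d + d) - p * d ∣ * w + sumℚ (map g (replicate (suc m) (d - s)))
      ≡⟨ cong₂ (λ a r → a * w + r) abs-top (sumℚ-replicate g (suc m) (d - s)) ⟩
    p * d * w + ℕ→ℚ (suc m) * (∣ p * (d - s) - p * d ∣ * w)        ≡⟨ cong (λ a → p * d * w + ℕ→ℚ (suc m) * (a * w)) abs-rest ⟩
    p * d * w + ℕ→ℚ (suc m) * (p * s * w)                          ≡⟨ factor d (ℕ→ℚ (suc m)) s p w ⟩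
    (d + d) * (p * w)                                              ≡⟨ cong (_*_ (d + d)) (ℕ→ℚ-*-inverse (suc m)) ⟩
    (d + d) * 1ℚ                                                   ≡⟨ ℚ.*-identityʳ (d + d) ⟩
    energy                                                         ∎
    where
    open ≡-Reasoning
    g : ℚ → ℚ
    g σ = ∣ p * σ - p * d ∣ * w
    factor : ∀ d k s p w → p * d * w + k * (p * s * w) ≡ (d + k * s) * (p * w)
    factor = solve 5 (λ d k s p w → p :* d :* w :+ k :* (p :* s :* w) := (d :+ k :* s) :* (p :* w)) refl

  LEPlusCN-complete : LEPlusCN≡ K energy
  LEPlusCN-complete = spectrum , IsSpectrum-K , LE-complete

-- (k-1)(k+2) ≤ k(k-1)(k+1), written with m = k - 1
star≤complete-ℕ : ∀ m → 2 ℕ.* m ℕ.* (3 ℕ.+ m) ℕ.≤ 2 ℕ.* (suc m ℕ.* m) ℕ.* (2 ℕ.+ m)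
star≤complete-ℕ zero    = ℕ.z≤n
star≤complete-ℕ (suc n) = begin
  2 ℕ.* suc n ℕ.* (4 ℕ.+ n)                                                  ≤⟨ ℕ.m≤m+n _ _ ⟩
  2 ℕ.* suc n ℕ.* (4 ℕ.+ n) ℕ.+ 2 ℕ.* suc n ℕ.* (n ℕ.* n ℕ.+ 4 ℕ.* n ℕ.+ 2)  ≡⟨ expand n ⟨
  2 ℕ.* (suc (suc n) ℕ.* suc n) ℕ.* (3 ℕ.+ n)                                ∎
  where
  open ℕ.≤-Reasoning
  expand : ∀ n → 2 ℕ.* (suc (suc n) ℕ.* suc n) ℕ.* (3 ℕ.+ n)
               ≡ 2 ℕ.* suc n ℕ.* (4 ℕ.+ n) ℕ.+ 2 ℕ.* suc n ℕ.* (n ℕ.* n ℕ.+ 4 ℕ.* n ℕ.+ 2)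
  expand = ℕ-Ring.solve-∀

star≤complete : ∀ m → Star.energy m ≤ Complete.energy m
star≤complete m = begin
  ℕ→ℚ (2 ℕ.* m ℕ.* (3 ℕ.+ m)) * w             ≤⟨ ℚ.*-monoʳ-≤-nonNeg w {{ℚ.nonNegative (1/suc-nonNeg (suc m))}}
                                                                       (ℕ→ℚ-mono-≤ (star≤complete-ℕ m)) ⟩
  ℕ→ℚ (2 ℕ.* (suc m ℕ.* m) ℕ.* (2 ℕ.+ m)) * w  ≡⟨ cong (_* w) cast ⟩
  ℕ→ℚ 2 * d * p * w                            ≡⟨ regroup d p w ⟩
  (d + d) * (p * w)                            ≡⟨ cong (_*_ (d + d)) (ℕ→ℚ-*-inverse (suc m)) ⟩
  (d + d) * 1ℚ                                 ≡⟨ ℚ.*-identityʳ (d + d) ⟩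
  d + d                                        ∎
  where
  open ℚ.≤-Reasoning
  open Complete m using (d)
  p w : ℚ
  p = ℕ→ℚ (suc (suc m))
  w = + 1 / suc (suc m)
  cast : ℕ→ℚ (2 ℕ.* (suc m ℕ.* m) ℕ.* (2 ℕ.+ m)) ≡ ℕ→ℚ 2 * d * p
  cast = trans (ℕ→ℚ-homo-* (2 ℕ.* (suc m ℕ.* m)) (2 ℕ.+ m))
               (cong (_* p) (trans (ℕ→ℚ-homo-* 2 (suc m ℕ.* m)) (cong (_*_ (ℕ→ℚ 2)) (ℕ→ℚ-homo-* (suc m) m))))
  regroup : ∀ d p w → ℕ→ℚ 2 * d * p * w ≡ (d + d) * (p * w)
  regroup = solve 3 (λ d p w → con (ℕ→ℚ 2) :* d :* p :* w := (d :+ d) :* (p :* w)) refl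

corollary3p7 : (k : ℕ) → k ≥ 1 →
    IsSpectrum (CNSL (star k))
    (0ℚ ∷ ℤ→ℚ ((+ 2) ℤ.* (+ k ℤ.- + 1)) ∷ replicate (k ∸ 1) (ℤ→ℚ (+ k ℤ.- + 2)))
    × LEPlusCN≡ (star k) (((+ 2) ℤ.* (+ k ℤ.- + 1) ℤ.* (+ k ℤ.+ + 2)) / suc k)
    × ¬ CNSLHyperenergetic (star k)
corollary3p7 (suc m) _ =
    subst (IsSpectrum (CNSL S)) (sym (cong (0ℚ ∷_) (cong₂ _∷_ ℤ→ℚ-top (cong (replicate m) ℤ→ℚ-leaf)))) IsSpectrum-star
  , subst (LEPlusCN≡ S) (sym /≡energy) LEPlusCN-star
  , λ (a , b , LE≡a , LE≡b , b<a) → ℚ.<-irrefl refl (ℚ.<-≤-trans b<a (subst₂ _≤_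
      (LEPlusCN≡-unique S LEPlusCN-star LE≡a)
      (LEPlusCN≡-unique (complete (suc (suc m))) (Complete.LEPlusCN-complete m) LE≡b)
      (star≤complete m)))
  where open Star m
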